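{- For every integer $n\geq1$: \begin{gather*} T_{2n-1}(x) - 2(2x^2-x-1)\sum_{k=1}^{n-1}U_{k-1}(x)T_{2n-2k-1}(x) = x\bigl(U_{n-1}(x)-U_{n-2}(x)\bigr),\\ T_{2n-2}(x) - 2(2x^2-x-1)\sum_{k=1}^{n-1}U_{k-1}(x)T_{2(n-k-1)}(x) = U_{n-1}(x)-(2x^2-1)U_{n-2}(x),\\ T_{n}(x) + T_{n-1}(x) + 2(2x^2-x-1)\sum_{k=0}^{n-1}U_{2k} (x)T_{n-k-1}(x) = U_{2n}(x)-xU_{2(n-1)}(x),\\ 2xT_{n-1}(x) +2(2x^2-x-1)\sum_{k=1}^{n-1}U_{2k-1}(x)T_{n-k-1}(x) = U_{2n-1}(x)-xU_{2n-3}(x). \end{gather*}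
   Context: $T_n(x)$ and $U_n(x)$ are the Chebyshev polynomials of the first and second kind, defined by $W_n(x)=2xW_{n-1}(x)-W_{n-2}(x)$ for $n\geq2$ with $T_0=1$, $T_1=x$, $U_0=1$, $U_1=2x$; the convention $U_{ -1}(x)=0$ is used (needed for $n=1$). Empty sums are $0$. -}

module Defs where

open import Level using (Level)
open import Data.Nat using (ℕ; zero; suc; _∸_)
import Data.Nat as N
open import Algebra.Bundles using (CommutativeRing)

-- Chebyshev polynomials evaluated at an element x of an arbitrary
-- commutative ring (polynomial identities hold in ℤ[x], hence in every
-- commutative ring, and conversely the case R = ℤ[x] is the identity itself).
module Chebyshev {c ℓ : Level} (R : CommutativeRing c ℓ) where
  open CommutativeRing R

  infixl 6 _⊖_
  _⊖_ : Carrier → Carrier → Carrier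
  a ⊖ b = a + (- b)

  two : Carrier
  two = 1# + 1#

  T : Carrier → ℕ → Carrier
  T x zero = 1#
  T x (suc zero) = x
  T x (suc (suc n)) = two * x * T x (suc n) ⊖ T x n

  U : Carrier → ℕ → Carrier
  U x zero = 1#
  U x (suc zero) = two * x
  U x (suc (suc n)) = two * x * U x (suc n) ⊖ U x n

  -- Ushift x m = U_{m-1}(x), with the convention U_{-1}(x) = 0
  Ushift : Carrier → ℕ → Carrier
  Ushift x zero = 0#
  Ushift x (suc m) = U x m

  sumBelow : ℕ → (ℕ → Carrier) → Carrier
  sumBelow zero f = 0#
  sumBelow (suc m) f = sumBelow m f + f m

  -- ∑_{k=lo}^{hi} f k   (empty, i.e. 0, when hi < lo)
  sumFromTo : ℕ → ℕ → (ℕ → Carrier) → Carrier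
  sumFromTo lo hi f = sumBelow (suc hi ∸ lo) (λ j → f (lo N.+ j))

-- With κ = 2(2x² − x − 1), each identity says that a difference D_m of Chebyshev
-- values equals κ · Σ_{j+d=m−1} a_j b_d, where b is T or one of its every-other-term
-- subsequences and therefore satisfies b_{i+2} = c b_{i+1} − b_i (c = 2x, resp. (2x)² − 2).
-- Such a convolution satisfies the same recurrence up to the forcing term
-- a_m (b_1 − c b_0) + a_{m+1} b_0.  Using the Chebyshev recurrences, D_m satisfies it
-- with κ times that forcing term, so both sides agree once they agree for m = 0, 1.

module Submission where

open import Defs
open import Level using (Level)
open import Data.Nat using (ℕ; zero; suc; _∸_; _≤_)
import Data.Nat as ℕ
import Data.Nat.Properties as ℕ
open import Data.Integer using (ℤ; +_; -[1+_]; sign; ∣_∣; _◃_)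
import Data.Integer as ℤ
import Data.Integer.Properties as ℤ
open import Data.Sign as Sign using (Sign)
open import Data.Product using (_×_; _,_; proj₁)
open import Data.Maybe using (Maybe; nothing; just)
open import Relation.Nullary using (yes; no)
open import Algebra.Bundles using (CommutativeRing)
open import Relation.Binary.PropositionalEquality as ≡ using (_≡_)

module IntegerCoefficients {c ℓ : Level} (R : CommutativeRing c ℓ) where
  open CommutativeRing R
  open import Algebra.Properties.Semiring.Mult.TCOptimised semiring
    using (1+×; ×-homo-+; ×1-homo-*) renaming (_×_ to _·_)
  open import Algebra.Properties.Ring ring using (-1*x≈-x; -‿involutive; -0#≈0#; -‿+-comm)
  open import Algebra.Properties.CommutativeSemigroup +-commutativeSemigroup
    using () renaming (interchange to +-interchange)
  open import Algebra.Properties.CommutativeSemigroup *-commutativeSemigroup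
    using () renaming (interchange to *-interchange)
  open import Algebra.Solver.Ring.AlmostCommutativeRing
    using (fromCommutativeRing; _-Raw-AlmostCommutative⟶_)
  open import Relation.Binary.Reasoning.Setoid setoid

  -- The optimised _·_ makes fromℤ (+ 1) and fromℤ (+ 2) reduce to 1# and 1# + 1# = two,
  -- so that solver goals match terms written with 1# and two.
  fromℤ : ℤ → Carrier
  fromℤ (+ n) = n · 1#
  fromℤ -[1+ n ] = - (suc n · 1#)

  ⊖-homo : ∀ m n → fromℤ (m ℤ.⊖ n) ≈ m · 1# - n · 1#
  ⊖-homo zero zero = sym (-‿inverseʳ 0#)
  ⊖-homo (suc m) zero = sym (trans (+-congˡ -0#≈0#) (+-identityʳ _))
  ⊖-homo zero (suc n) = sym (+-identityˡ _)
  ⊖-homo (suc m) (suc n) = begin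
    fromℤ (suc m ℤ.⊖ suc n)          ≡⟨ ≡.cong fromℤ (ℤ.[1+m]⊖[1+n]≡m⊖n m n) ⟩
    fromℤ (m ℤ.⊖ n)                  ≈⟨ ⊖-homo m n ⟩
    m · 1# - n · 1#                  ≈⟨ +-identityˡ _ ⟨
    0# + (m · 1# - n · 1#)           ≈⟨ +-congʳ (-‿inverseʳ 1#) ⟨
    (1# - 1#) + (m · 1# - n · 1#)    ≈⟨ +-interchange 1# (- 1#) (m · 1#) (- (n · 1#)) ⟩
    (1# + m · 1#) + (- 1# - n · 1#)  ≈⟨ +-cong (1+× m 1#) (trans (-‿cong (1+× n 1#)) (sym (-‿+-comm _ _))) ⟨
    suc m · 1# - suc n · 1#          ∎

  +-homo : ∀ i j → fromℤ (i ℤ.+ j) ≈ fromℤ i + fromℤ j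
  +-homo (+ m) (+ n) = ×-homo-+ 1# m n
  +-homo (+ m) -[1+ n ] = ⊖-homo m (suc n)
  +-homo -[1+ m ] (+ n) = trans (⊖-homo n (suc m)) (+-comm _ _)
  +-homo -[1+ m ] -[1+ n ] = begin
    - (suc (suc (m ℕ.+ n)) · 1#)      ≡⟨ ≡.cong (λ k → - (suc k · 1#)) (ℕ.+-suc m n) ⟨
    - ((suc m ℕ.+ suc n) · 1#)        ≈⟨ -‿cong (×-homo-+ 1# (suc m) (suc n)) ⟩
    - (suc m · 1# + suc n · 1#)       ≈⟨ -‿+-comm _ _ ⟨
    - (suc m · 1#) - suc n · 1#       ∎

  -‿homo : ∀ i → fromℤ (ℤ.- i) ≈ - fromℤ i
  -‿homo (+ zero) = sym -0#≈0#
  -‿homo (+ suc n) = refl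
  -‿homo -[1+ n ] = sym (-‿involutive _)

  fromSign : Sign → Carrier
  fromSign Sign.+ = 1#
  fromSign Sign.- = - 1#

  ◃-homo : ∀ s n → fromℤ (s ◃ n) ≈ fromSign s * n · 1#
  ◃-homo s zero = sym (zeroʳ _)
  ◃-homo Sign.+ (suc n) = sym (*-identityˡ _)
  ◃-homo Sign.- (suc n) = sym (-1*x≈-x _)

  sign-abs : ∀ i → fromℤ i ≈ fromSign (sign i) * ∣ i ∣ · 1#
  sign-abs (+ n) = sym (*-identityˡ _)
  sign-abs -[1+ n ] = sym (-1*x≈-x _)

  sign-*-homo : ∀ s t → fromSign (s Sign.* t) ≈ fromSign s * fromSign t
  sign-*-homo Sign.+ t = sym (*-identityˡ _)
  sign-*-homo Sign.- Sign.+ = sym (*-identityʳ _)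
  sign-*-homo Sign.- Sign.- = sym (trans (-1*x≈-x _) (-‿involutive _))

  *-homo : ∀ i j → fromℤ (i ℤ.* j) ≈ fromℤ i * fromℤ j
  *-homo i j = begin
    fromℤ (sign i Sign.* sign j ◃ ∣ i ∣ ℕ.* ∣ j ∣)
      ≈⟨ ◃-homo (sign i Sign.* sign j) (∣ i ∣ ℕ.* ∣ j ∣) ⟩
    fromSign (sign i Sign.* sign j) * (∣ i ∣ ℕ.* ∣ j ∣) · 1#
      ≈⟨ *-cong (sign-*-homo (sign i) (sign j)) (×1-homo-* ∣ i ∣ ∣ j ∣) ⟩
    (fromSign (sign i) * fromSign (sign j)) * (∣ i ∣ · 1# * ∣ j ∣ · 1#)
      ≈⟨ *-interchange _ _ _ _ ⟩
    (fromSign (sign i) * ∣ i ∣ · 1#) * (fromSign (sign j) * ∣ j ∣ · 1#)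
      ≈⟨ *-cong (sign-abs i) (sign-abs j) ⟨
    fromℤ i * fromℤ j
      ∎

  ℤ⟶R : ℤ.+-*-rawRing -Raw-AlmostCommutative⟶ fromCommutativeRing R
  ℤ⟶R = record
    { ⟦_⟧ = fromℤ ; +-homo = +-homo ; *-homo = *-homo ; -‿homo = -‿homo
    ; 0-homo = refl ; 1-homo = refl }

  fromℤ-≟ : ∀ i j → Maybe (fromℤ i ≈ fromℤ j)
  fromℤ-≟ i j with i ℤ.≟ j
  ... | yes i≡j = just (reflexive (≡.cong fromℤ i≡j))
  ... | no _ = nothing

  open import Algebra.Solver.Ring ℤ.+-*-rawRing (fromCommutativeRing R) ℤ⟶R fromℤ-≟ public

  𝟘 𝟙 𝟚 : ∀ {n} → Polynomial n
  𝟘 = con (+ 0)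
  𝟙 = con (+ 1)
  𝟚 = con (+ 2)

module Recurrences {r ℓ : Level} (R : CommutativeRing r ℓ) where
  open CommutativeRing R
  open Chebyshev R using (_⊖_; two; sumBelow)
  open IntegerCoefficients R using (solve; _:=_; _:+_; _:*_; _:-_; 𝟘; 𝟙; 𝟚)
  open import Relation.Binary.Reasoning.Setoid setoid

  Recurrence : Carrier → (ℕ → Carrier) → Set ℓ
  Recurrence c s = ∀ i → s (suc (suc i)) ≈ c * s (suc i) ⊖ s i

  ForcedRecurrence : Carrier → (ℕ → Carrier) → (ℕ → Carrier) → Set ℓ
  ForcedRecurrence c f s = ∀ i → s (suc (suc i)) ≈ c * s (suc i) ⊖ s i + f i

  difference≈0 : ∀ a {u v} → u ≈ v → a * (u ⊖ v) ≈ 0#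
  difference≈0 a {u} {v} u≈v = begin
    a * (u ⊖ v)  ≈⟨ *-congˡ (+-congʳ u≈v) ⟩
    a * (v ⊖ v)  ≈⟨ *-congˡ (-‿inverseʳ v) ⟩
    a * 0#       ≈⟨ zeroʳ a ⟩
    0#           ∎

  +-≈0 : ∀ {z w} → z ≈ 0# → w ≈ 0# → z + w ≈ 0#
  +-≈0 z≈0 w≈0 = trans (+-cong z≈0 w≈0) (+-identityʳ 0#)

  -- To derive u ≈ v from hypotheses uᵢ ≈ vᵢ, exhibit u − v as Σ aᵢ (uᵢ − vᵢ) and let solve check it.
  by-linear-combination : ∀ {u v z} → z ≈ 0# → u ≈ v + z → u ≈ v
  by-linear-combination {v = v} z≈0 u≈v+z = trans u≈v+z (trans (+-congˡ z≈0) (+-identityʳ v))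

  x-y≈z⇒x-z≈y : ∀ {a b c} → a ⊖ b ≈ c → a ⊖ c ≈ b
  x-y≈z⇒x-z≈y {a} {b} {c} a-b≈c = begin
    a ⊖ c        ≈⟨ +-congˡ (-‿cong a-b≈c) ⟨
    a ⊖ (a ⊖ b)  ≈⟨ solve 2 (λ a b → a :- (a :- b) := b) refl a b ⟩
    b            ∎

  y-x≈z⇒x+z≈y : ∀ {a b c} → b ⊖ a ≈ c → a + c ≈ b
  y-x≈z⇒x+z≈y {a} {b} {c} b-a≈c = begin
    a + c        ≈⟨ +-congˡ b-a≈c ⟨
    a + (b ⊖ a)  ≈⟨ solve 2 (λ a b → a :+ (b :- a) := b) refl a b ⟩
    b            ∎

  Recurrence-everyOther : ∀ {c s} → Recurrence c s → Recurrence (c * c ⊖ two) (λ d → s (d ℕ.* 2))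
  Recurrence-everyOther {c} {s} rec i = by-linear-combination
    (+-≈0 (+-≈0 (difference≈0 1# (rec (suc (suc k)))) (difference≈0 c (rec (suc k))))
           (difference≈0 1# (rec k)))
    (solve 6 (λ c s₀ s₁ s₂ s₃ s₄ →
        s₄ := (c :* c :- 𝟚) :* s₂ :- s₀
              :+ (𝟙 :* (s₄ :- (c :* s₃ :- s₂)) :+ c :* (s₃ :- (c :* s₂ :- s₁))
                  :+ 𝟙 :* (s₂ :- (c :* s₁ :- s₀))))
      refl c (s k) (s (suc k)) (s (suc (suc k))) (s (suc (suc (suc k)))) (s (suc (suc (suc (suc k))))))
    where k = i ℕ.* 2

  convolution : (ℕ → Carrier) → (ℕ → Carrier) → ℕ → Carrier
  convolution a b zero = 0#
  convolution a b (suc m) = a 0 * b m + convolution (λ j → a (suc j)) b m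

  convolutionForcing : Carrier → (ℕ → Carrier) → (ℕ → Carrier) → ℕ → Carrier
  convolutionForcing c a b m = a m * (b 1 ⊖ c * b 0) + a (suc m) * b 0

  convolution-forcedRecurrence : ∀ {c b} → Recurrence c b →
    ∀ a → ForcedRecurrence c (convolutionForcing c a b) (convolution a b)
  convolution-forcedRecurrence {c} {b} _ a zero =
    solve 5 (λ c a₀ a₁ b₀ b₁ → a₀ :* b₁ :+ (a₁ :* b₀ :+ 𝟘)
               := c :* (a₀ :* b₀ :+ 𝟘) :- 𝟘 :+ (a₀ :* (b₁ :- c :* b₀) :+ a₁ :* b₀))
      refl c (a 0) (a 1) (b 0) (b 1)
  convolution-forcedRecurrence {c} {b} rec a (suc m) = by-linear-combination
    (+-≈0 (difference≈0 (a 0) (rec m)) (difference≈0 1# (convolution-forcedRecurrence rec a′ m)))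
    (solve 12 (λ c a₀ b₀ b₁ bₘ bₘ₁ bₘ₂ v₀ v₁ v₂ aₘ₁ aₘ₂ →
        a₀ :* bₘ₂ :+ v₂
          := c :* (a₀ :* bₘ₁ :+ v₁) :- (a₀ :* bₘ :+ v₀) :+ (aₘ₁ :* (b₁ :- c :* b₀) :+ aₘ₂ :* b₀)
             :+ (a₀ :* (bₘ₂ :- (c :* bₘ₁ :- bₘ))
                 :+ 𝟙 :* (v₂ :- (c :* v₁ :- v₀ :+ (aₘ₁ :* (b₁ :- c :* b₀) :+ aₘ₂ :* b₀)))))
      refl c (a 0) (b 0) (b 1) (b m) (b (suc m)) (b (suc (suc m)))
        (convolution a′ b m) (convolution a′ b (suc m)) (convolution a′ b (suc (suc m)))
        (a (suc m)) (a (suc (suc m))))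
    where a′ = λ j → a (suc j)

  ForcedRecurrence-scale : ∀ {c f s} k → ForcedRecurrence c f s →
    ForcedRecurrence c (λ i → k * f i) (λ i → k * s i)
  ForcedRecurrence-scale {c} {f} {s} k rec i = begin
    k * s (suc (suc i))
      ≈⟨ *-congˡ (rec i) ⟩
    k * (c * s (suc i) ⊖ s i + f i)
      ≈⟨ solve 5 (λ k c s₀ s₁ f → k :* (c :* s₁ :- s₀ :+ f) := c :* (k :* s₁) :- k :* s₀ :+ k :* f)
               refl k c (s i) (s (suc i)) (f i) ⟩
    c * (k * s (suc i)) ⊖ k * s i + k * f i
      ∎

  ForcedRecurrence-unique : ∀ {c f s t} → ForcedRecurrence c f s → ForcedRecurrence c f t →
    s 0 ≈ t 0 → s 1 ≈ t 1 → ∀ m → s m ≈ t m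
  ForcedRecurrence-unique {c} {f} {s} {t} recₛ recₜ s₀≈t₀ s₁≈t₁ m = proj₁ (consecutive m)
    where
    consecutive : ∀ m → s m ≈ t m × s (suc m) ≈ t (suc m)
    consecutive zero = s₀≈t₀ , s₁≈t₁
    consecutive (suc m) with consecutive m
    ... | sₘ≈tₘ , sₘ₊₁≈tₘ₊₁ = sₘ₊₁≈tₘ₊₁ , (begin
      s (suc (suc m))            ≈⟨ recₛ m ⟩
      c * s (suc m) ⊖ s m + f m  ≈⟨ +-congʳ (+-cong (*-congˡ sₘ₊₁≈tₘ₊₁) (-‿cong sₘ≈tₘ)) ⟩
      c * t (suc m) ⊖ t m + f m  ≈⟨ recₜ m ⟨
      t (suc (suc m))            ∎)

  sumBelow-suc : ∀ m f → sumBelow (suc m) f ≈ f 0 + sumBelow m (λ j → f (suc j))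
  sumBelow-suc zero f = +-comm _ _
  sumBelow-suc (suc m) f = trans (+-congʳ (sumBelow-suc m f)) (+-assoc _ _ _)

  sumBelow-convolution : ∀ m {a b f} → (∀ j d → suc (j ℕ.+ d) ≡ m → f j ≈ a j * b d) →
    sumBelow m f ≈ convolution a b m
  sumBelow-convolution zero f≈ab = refl
  sumBelow-convolution (suc m) {f = f} f≈ab = trans (sumBelow-suc m f)
    (+-cong (f≈ab 0 m ≡.refl) (sumBelow-convolution m (λ j d eq → f≈ab (suc j) d (≡.cong suc eq))))

[1+j+d]∸j≡1+d : ∀ j d → suc (j ℕ.+ d) ∸ j ≡ suc d
[1+j+d]∸j≡1+d j d = ≡.trans (≡.cong (_∸ j) (≡.sym (ℕ.+-suc j d))) (ℕ.m+n∸m≡n j (suc d))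

[1+j+d]∸j∸1≡d : ∀ j d → suc (j ℕ.+ d) ∸ j ∸ 1 ≡ d
[1+j+d]∸j∸1≡d j d = ≡.cong (_∸ 1) ([1+j+d]∸j≡1+d j d)

2[2+j+d]∸2[1+j]≡[1+d]2 : ∀ j d → 2 ℕ.* suc (suc (j ℕ.+ d)) ∸ 2 ℕ.* suc j ≡ suc d ℕ.* 2
2[2+j+d]∸2[1+j]≡[1+d]2 j d = begin
  2 ℕ.* suc (suc (j ℕ.+ d)) ∸ 2 ℕ.* suc j  ≡⟨ ℕ.*-distribˡ-∸ 2 (suc (suc (j ℕ.+ d))) (suc j) ⟨
  2 ℕ.* (suc (j ℕ.+ d) ∸ j)                ≡⟨ ≡.cong (2 ℕ.*_) ([1+j+d]∸j≡1+d j d) ⟩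
  2 ℕ.* suc d                              ≡⟨ ℕ.*-comm 2 (suc d) ⟩
  suc d ℕ.* 2                              ∎
  where open ≡.≡-Reasoning

module ChebyshevConvolutions {r ℓ : Level} (R : CommutativeRing r ℓ) (x : CommutativeRing.Carrier R) where
  open CommutativeRing R
  open Chebyshev R
  open IntegerCoefficients R using (Polynomial; solve; _:=_; _:+_; _:*_; _:-_; :-_; 𝟘; 𝟙; 𝟚)
  open Recurrences R
  open import Relation.Binary.Reasoning.Setoid setoid

  -- For numerals n, Tₚ X n and Uₚ X n evaluate to T x n and U x n, so solve checks initial values.
  Tₚ Uₚ : ∀ {n} → Polynomial n → ℕ → Polynomial n
  Tₚ X zero = 𝟙
  Tₚ X (suc zero) = X
  Tₚ X (suc (suc n)) = 𝟚 :* X :* Tₚ X (suc n) :- Tₚ X n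
  Uₚ X zero = 𝟙
  Uₚ X (suc zero) = 𝟚 :* X
  Uₚ X (suc (suc n)) = 𝟚 :* X :* Uₚ X (suc n) :- Uₚ X n

  κ : Carrier
  κ = two * (two * (x * x) ⊖ x ⊖ 1#)

  κₚ : ∀ {n} → Polynomial n → Polynomial n
  κₚ X = 𝟚 :* (𝟚 :* (X :* X) :- X :- 𝟙)

  γ : Carrier
  γ = two * x * (two * x) ⊖ two

  γₚ : ∀ {n} → Polynomial n → Polynomial n
  γₚ X = 𝟚 :* X :* (𝟚 :* X) :- 𝟚

  T-recurrence : Recurrence (two * x) (T x)
  T-recurrence _ = refl

  U-recurrence : Recurrence (two * x) (U x)
  U-recurrence _ = refl

  Ushift-recurrence : Recurrence (two * x) (Ushift x)
  Ushift-recurrence zero = solve 1 (λ X → Uₚ X 1 := 𝟚 :* X :* Uₚ X 0 :- 𝟘) refl x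
  Ushift-recurrence (suc i) = refl

  oddT : ℕ → Carrier
  oddT d = T x (suc (d ℕ.* 2))

  T-odd-convolution : ∀ m → oddT m ⊖ x * (U x m ⊖ Ushift x m) ≈ κ * convolution (U x) oddT m
  T-odd-convolution = ForcedRecurrence-unique defect-recurrence
    (ForcedRecurrence-scale κ (convolution-forcedRecurrence oddT-recurrence (U x)))
    (solve 1 (λ X → Tₚ X 1 :- X :* (Uₚ X 0 :- 𝟘) := κₚ X :* 𝟘) refl x)
    (solve 1 (λ X → Tₚ X 3 :- X :* (Uₚ X 1 :- Uₚ X 0) := κₚ X :* (Uₚ X 0 :* Tₚ X 1 :+ 𝟘)) refl x)
    where
    oddT-recurrence : Recurrence γ oddT
    oddT-recurrence = Recurrence-everyOther (λ i → T-recurrence (suc i))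

    defect-recurrence : ForcedRecurrence γ (λ m → κ * convolutionForcing γ (U x) oddT m)
                          (λ m → oddT m ⊖ x * (U x m ⊖ Ushift x m))
    defect-recurrence m = by-linear-combination
      (+-≈0 (difference≈0 1# (oddT-recurrence m)) (difference≈0 x (Ushift-recurrence m)))
      (solve 7 (λ X A₀ A₁ A₂ V₀ V₁ W →
          A₂ :- X :* ((𝟚 :* X :* V₁ :- V₀) :- V₁)
            := γₚ X :* (A₁ :- X :* (V₁ :- V₀)) :- (A₀ :- X :* (V₀ :- W))
               :+ κₚ X :* (V₀ :* (Tₚ X 3 :- γₚ X :* Tₚ X 1) :+ V₁ :* Tₚ X 1)
               :+ (𝟙 :* (A₂ :- (γₚ X :* A₁ :- A₀)) :+ X :* (V₁ :- (𝟚 :* X :* V₀ :- W))))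
        refl x (oddT m) (oddT (suc m)) (oddT (suc (suc m))) (U x m) (U x (suc m)) (Ushift x m))

  evenT : ℕ → Carrier
  evenT d = T x (d ℕ.* 2)

  T-even-convolution : ∀ m → evenT m ⊖ (U x m ⊖ (two * (x * x) ⊖ 1#) * Ushift x m)
                             ≈ κ * convolution (U x) evenT m
  T-even-convolution = ForcedRecurrence-unique defect-recurrence
    (ForcedRecurrence-scale κ (convolution-forcedRecurrence evenT-recurrence (U x)))
    (solve 1 (λ X → Tₚ X 0 :- (Uₚ X 0 :- (𝟚 :* (X :* X) :- 𝟙) :* 𝟘) := κₚ X :* 𝟘) refl x)
    (solve 1 (λ X → Tₚ X 2 :- (Uₚ X 1 :- (𝟚 :* (X :* X) :- 𝟙) :* Uₚ X 0)
                    := κₚ X :* (Uₚ X 0 :* Tₚ X 0 :+ 𝟘)) refl x)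
    where
    evenT-recurrence : Recurrence γ evenT
    evenT-recurrence = Recurrence-everyOther T-recurrence

    defect-recurrence : ForcedRecurrence γ (λ m → κ * convolutionForcing γ (U x) evenT m)
                          (λ m → evenT m ⊖ (U x m ⊖ (two * (x * x) ⊖ 1#) * Ushift x m))
    defect-recurrence m = by-linear-combination
      (+-≈0 (difference≈0 1# (evenT-recurrence m))
            (difference≈0 (two * (x * x) ⊖ 1#) (Ushift-recurrence m)))
      (solve 7 (λ X A₀ A₁ A₂ V₀ V₁ W →
          A₂ :- ((𝟚 :* X :* V₁ :- V₀) :- (𝟚 :* (X :* X) :- 𝟙) :* V₁)
            := γₚ X :* (A₁ :- (V₁ :- (𝟚 :* (X :* X) :- 𝟙) :* V₀))
               :- (A₀ :- (V₀ :- (𝟚 :* (X :* X) :- 𝟙) :* W))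
               :+ κₚ X :* (V₀ :* (Tₚ X 2 :- γₚ X :* Tₚ X 0) :+ V₁ :* Tₚ X 0)
               :+ (𝟙 :* (A₂ :- (γₚ X :* A₁ :- A₀))
                   :+ (𝟚 :* (X :* X) :- 𝟙) :* (V₁ :- (𝟚 :* X :* V₀ :- W))))
        refl x (evenT m) (evenT (suc m)) (evenT (suc (suc m))) (U x m) (U x (suc m)) (Ushift x m))

  evenU : ℕ → Carrier
  evenU d = U x (d ℕ.* 2)

  U-even-convolution : ∀ m → evenU (suc m) ⊖ x * evenU m ⊖ (T x (suc m) + T x m)
                             ≈ κ * convolution evenU (T x) (suc m)
  U-even-convolution = ForcedRecurrence-unique defect-recurrence
    (ForcedRecurrence-scale κ (λ i → convolution-forcedRecurrence T-recurrence evenU (suc i)))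
    (solve 1 (λ X → Uₚ X 2 :- X :* Uₚ X 0 :- (Tₚ X 1 :+ Tₚ X 0)
                    := κₚ X :* (Uₚ X 0 :* Tₚ X 0 :+ 𝟘)) refl x)
    (solve 1 (λ X → Uₚ X 4 :- X :* Uₚ X 2 :- (Tₚ X 2 :+ Tₚ X 1)
                    := κₚ X :* (Uₚ X 0 :* Tₚ X 1 :+ (Uₚ X 2 :* Tₚ X 0 :+ 𝟘))) refl x)
    where
    evenU-recurrence : Recurrence γ evenU
    evenU-recurrence = Recurrence-everyOther U-recurrence

    defect-recurrence : ForcedRecurrence (two * x)
                          (λ m → κ * convolutionForcing (two * x) evenU (T x) (suc m))
                          (λ m → evenU (suc m) ⊖ x * evenU m ⊖ (T x (suc m) + T x m))
    defect-recurrence m = by-linear-combination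
      (+-≈0 (difference≈0 1# (evenU-recurrence (suc m))) (difference≈0 (- x) (evenU-recurrence m)))
      (solve 7 (λ X U₀ U₂ U₄ U₆ T₀ T₁ →
          U₆ :- X :* U₄ :- ((𝟚 :* X :* (𝟚 :* X :* T₁ :- T₀) :- T₁) :+ (𝟚 :* X :* T₁ :- T₀))
            := 𝟚 :* X :* (U₄ :- X :* U₂ :- ((𝟚 :* X :* T₁ :- T₀) :+ T₁))
               :- (U₂ :- X :* U₀ :- (T₁ :+ T₀))
               :+ κₚ X :* (U₂ :* (Tₚ X 1 :- 𝟚 :* X :* Tₚ X 0) :+ U₄ :* Tₚ X 0)
               :+ (𝟙 :* (U₆ :- (γₚ X :* U₄ :- U₂)) :+ (:- X) :* (U₄ :- (γₚ X :* U₂ :- U₀))))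
        refl x (evenU m) (evenU (suc m)) (evenU (suc (suc m))) (evenU (suc (suc (suc m))))
          (T x m) (T x (suc m)))

  oddU : ℕ → Carrier
  oddU d = U x (suc (d ℕ.* 2))

  U-odd-convolution : ∀ m → oddU m ⊖ x * Ushift x (m ℕ.* 2) ⊖ two * x * T x m
                            ≈ κ * convolution oddU (T x) m
  U-odd-convolution = ForcedRecurrence-unique defect-recurrence
    (ForcedRecurrence-scale κ (convolution-forcedRecurrence T-recurrence oddU))
    (solve 1 (λ X → Uₚ X 1 :- X :* 𝟘 :- 𝟚 :* X :* Tₚ X 0 := κₚ X :* 𝟘) refl x)
    (solve 1 (λ X → Uₚ X 3 :- X :* Uₚ X 1 :- 𝟚 :* X :* Tₚ X 1
                    := κₚ X :* (Uₚ X 1 :* Tₚ X 0 :+ 𝟘)) refl x)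
    where
    oddU-recurrence : Recurrence γ oddU
    oddU-recurrence = Recurrence-everyOther (λ i → U-recurrence (suc i))

    evenUshift-recurrence : Recurrence γ (λ d → Ushift x (d ℕ.* 2))
    evenUshift-recurrence = Recurrence-everyOther Ushift-recurrence

    defect-recurrence : ForcedRecurrence (two * x)
                          (λ m → κ * convolutionForcing (two * x) oddU (T x) m)
                          (λ m → oddU m ⊖ x * Ushift x (m ℕ.* 2) ⊖ two * x * T x m)
    defect-recurrence m = by-linear-combination
      (+-≈0 (difference≈0 1# (oddU-recurrence m)) (difference≈0 (- x) (evenUshift-recurrence m)))
      (solve 7 (λ X U₁ U₃ U₅ W T₀ T₁ →
          U₅ :- X :* U₃ :- 𝟚 :* X :* (𝟚 :* X :* T₁ :- T₀)
            := 𝟚 :* X :* (U₃ :- X :* U₁ :- 𝟚 :* X :* T₁) :- (U₁ :- X :* W :- 𝟚 :* X :* T₀)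
               :+ κₚ X :* (U₁ :* (Tₚ X 1 :- 𝟚 :* X :* Tₚ X 0) :+ U₃ :* Tₚ X 0)
               :+ (𝟙 :* (U₅ :- (γₚ X :* U₃ :- U₁)) :+ (:- X) :* (U₃ :- (γₚ X :* U₁ :- W))))
        refl x (oddU m) (oddU (suc m)) (oddU (suc (suc m))) (Ushift x (m ℕ.* 2))
          (T x m) (T x (suc m)))

  T-odd-sum : ∀ m → T x (2 ℕ.* suc m ∸ 1)
                      ⊖ κ * sumFromTo 1 m (λ k → U x (k ∸ 1) * T x (2 ℕ.* suc m ∸ 2 ℕ.* k ∸ 1))
                    ≈ x * (U x m ⊖ Ushift x m)
  T-odd-sum m = trans
    (+-cong (reflexive (≡.cong (λ i → T x (i ∸ 1)) (ℕ.*-comm 2 (suc m))))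
            (-‿cong (*-congˡ (sumBelow-convolution m (summand m)))))
    (x-y≈z⇒x-z≈y (T-odd-convolution m))
    where
    summand : ∀ m j d → suc (j ℕ.+ d) ≡ m →
              U x j * T x (2 ℕ.* suc m ∸ 2 ℕ.* suc j ∸ 1) ≈ U x j * oddT d
    summand .(suc (j ℕ.+ d)) j d ≡.refl =
      *-congˡ (reflexive (≡.cong (λ i → T x (i ∸ 1)) (2[2+j+d]∸2[1+j]≡[1+d]2 j d)))

  T-even-sum : ∀ m → T x (2 ℕ.* suc m ∸ 2)
                       ⊖ κ * sumFromTo 1 m (λ k → U x (k ∸ 1) * T x (2 ℕ.* (suc m ∸ k ∸ 1)))
                     ≈ U x m ⊖ (two * (x * x) ⊖ 1#) * Ushift x m
  T-even-sum m = trans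
    (+-cong (reflexive (≡.cong (λ i → T x (i ∸ 2)) (ℕ.*-comm 2 (suc m))))
            (-‿cong (*-congˡ (sumBelow-convolution m (summand m)))))
    (x-y≈z⇒x-z≈y (T-even-convolution m))
    where
    summand : ∀ m j d → suc (j ℕ.+ d) ≡ m → U x j * T x (2 ℕ.* (m ∸ j ∸ 1)) ≈ U x j * evenT d
    summand .(suc (j ℕ.+ d)) j d ≡.refl =
      *-congˡ (reflexive (≡.cong (T x)
        (≡.trans (≡.cong (2 ℕ.*_) ([1+j+d]∸j∸1≡d j d)) (ℕ.*-comm 2 d))))

  U-even-sum : ∀ m → T x (suc m) + T x m
                       + κ * sumFromTo 0 m (λ k → U x (2 ℕ.* k) * T x (suc m ∸ k ∸ 1))
                     ≈ U x (2 ℕ.* suc m) ⊖ x * U x (2 ℕ.* m)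
  U-even-sum m = trans
    (+-congˡ (*-congˡ (sumBelow-convolution (suc m) (summand m))))
    (trans (y-x≈z⇒x+z≈y (U-even-convolution m))
           (reflexive (≡.cong₂ (λ i j → U x i ⊖ x * U x j) (ℕ.*-comm (suc m) 2) (ℕ.*-comm m 2))))
    where
    summand : ∀ m j d → suc (j ℕ.+ d) ≡ suc m → U x (2 ℕ.* j) * T x (suc m ∸ j ∸ 1) ≈ evenU j * T x d
    summand .(j ℕ.+ d) j d ≡.refl =
      *-cong (reflexive (≡.cong (U x) (ℕ.*-comm 2 j))) (reflexive (≡.cong (T x) ([1+j+d]∸j∸1≡d j d)))

  U-odd-sum : ∀ m → two * x * T x m
                      + κ * sumFromTo 1 m (λ k → U x (2 ℕ.* k ∸ 1) * T x (suc m ∸ k ∸ 1))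
                    ≈ U x (2 ℕ.* suc m ∸ 1) ⊖ x * Ushift x (2 ℕ.* suc m ∸ 2)
  U-odd-sum m = trans
    (+-congˡ (*-congˡ (sumBelow-convolution m (summand m))))
    (trans (y-x≈z⇒x+z≈y (U-odd-convolution m))
           (reflexive (≡.cong (λ i → U x (i ∸ 1) ⊖ x * Ushift x (i ∸ 2)) (ℕ.*-comm (suc m) 2))))
    where
    summand : ∀ m j d → suc (j ℕ.+ d) ≡ m → U x (2 ℕ.* suc j ∸ 1) * T x (m ∸ j ∸ 1) ≈ oddU j * T x d
    summand .(suc (j ℕ.+ d)) j d ≡.refl =
      *-cong (reflexive (≡.cong (λ i → U x (i ∸ 1)) (ℕ.*-comm 2 (suc j))))
             (reflexive (≡.cong (T x) ([1+j+d]∸j∸1≡d j d)))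

corollary8 : {c ℓ : Level} (R : CommutativeRing c ℓ) →
    let open CommutativeRing R
        open Chebyshev R
    in (x : Carrier) (n : ℕ) → 1 ≤ n →
       let q = two * (x * x) ⊖ x ⊖ 1#
       in (T x (Data.Nat._*_ 2 n ∸ 1)
             ⊖ two * q * sumFromTo 1 (n ∸ 1) (λ k → U x (k ∸ 1) * T x (Data.Nat._*_ 2 n ∸ Data.Nat._*_ 2 k ∸ 1))
           ≈ x * (U x (n ∸ 1) ⊖ Ushift x (n ∸ 1)))
        × (T x (Data.Nat._*_ 2 n ∸ 2)
             ⊖ two * q * sumFromTo 1 (n ∸ 1) (λ k → U x (k ∸ 1) * T x (Data.Nat._*_ 2 (n ∸ k ∸ 1)))
           ≈ U x (n ∸ 1) ⊖ (two * (x * x) ⊖ 1#) * Ushift x (n ∸ 1))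
        × (T x n + T x (n ∸ 1)
             + two * q * sumFromTo 0 (n ∸ 1) (λ k → U x (Data.Nat._*_ 2 k) * T x (n ∸ k ∸ 1))
           ≈ U x (Data.Nat._*_ 2 n) ⊖ x * U x (Data.Nat._*_ 2 (n ∸ 1)))
        × (two * x * T x (n ∸ 1)
             + two * q * sumFromTo 1 (n ∸ 1) (λ k → U x (Data.Nat._*_ 2 k ∸ 1) * T x (n ∸ k ∸ 1))
           ≈ U x (Data.Nat._*_ 2 n ∸ 1) ⊖ x * Ushift x (Data.Nat._*_ 2 n ∸ 2))
corollary8 R x (suc m) _ = T-odd-sum m , T-even-sum m , U-even-sum m , U-odd-sum m
  where open ChebyshevConvolutions R x
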